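{- Let $p$ be a prime. Then $$\lim_{n\to\infty}\frac{\left\lfloor \frac{n}{2p}\right\rceil+\left\lfloor \frac{n}{2p^2}\right\rceil+\cdots}{\left\lfloor\frac{n-1}{p-1}\right\rfloor}=\frac12.$$
   Context: $\lfloor x\rceil$ denotes the nonnegative integer closest to $x\in\mathbb{R}$, with $\lfloor x\rceil=0$ for all $x<1/2$ and $\lfloor N+\tfrac12\rceil=N+1$ for $N\in\mathbb{Z}_{\ge0}$; $\lfloor\cdot\rfloor$ is the usual floor. The sum in the numerator is $\sum_{t\ge1}\lfloor n/(2p^t)\rceil$ (finitely many nonzero terms). -}

module Defs where

open import Data.Nat using (ℕ; zero; suc; _+_; _*_; _∸_; _^_; _≥_)
open import Data.Nat.Properties using (m^n≢0; m*n≢0)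
import Data.Nat.DivMod as ℕD
open import Data.Integer using (ℤ; +_; -[1+_])
open import Data.Rational using (ℚ; floor; ½; _-_; ∣_∣; _<_; 0ℚ; Positive)
  renaming (_/_ to _/ℚ_; _+_ to _+ℚ_)
open import Data.Product using (∃; Σ; _×_)

-- ⌊ x ⌉ : the nonnegative integer closest to x, ties rounded up,
-- and 0 for x < 1/2.  Realised as max(0, ⌊ x + 1/2 ⌋).
roundNN : ℚ → ℕ
roundNN x with floor (x +ℚ ½)
... | + m = m
... | -[1+ _ ] = 0

-- the term ⌊ n / (2 p^t) ⌉ (as a rational), for p ≥ 1; p = 0 never occurs (p prime)
term : ℕ → ℕ → ℕ → ℕ
term zero n t = 0
term (suc k) n t = roundNN ((+ n) /ℚ (2 * suc k ^ t))
  where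
  instance
    nz : Data.Nat.NonZero (2 * suc k ^ t)
    nz = m*n≢0 2 (suc k ^ t) {{_}} {{m^n≢0 (suc k) t}}

sumFrom1 : ℕ → (ℕ → ℕ) → ℕ
sumFrom1 zero f = 0
sumFrom1 (suc m) f = sumFrom1 m f + f (suc m)

-- numerator  Σ_{t ≥ 1} ⌊ n / (2 p^t) ⌉.  For p ≥ 2 every term with t > n
-- vanishes (p^t ≥ 2^t > n, so n/(2p^t) < 1/2), hence summing t = 1..n
-- gives the whole (finite) series.
numer : ℕ → ℕ → ℕ
numer p n = sumFrom1 n (term p n)

-- denominator ⌊ (n-1)/(p-1) ⌋ for p ≥ 2 (p = 0,1 never occur: p prime)
denom : ℕ → ℕ → ℕ
denom (suc (suc k)) n = (n ∸ 1) ℕD./ suc k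
denom _ n = 0

-- the quotient numer/denom as a rational; set to 0 when denom = 0
-- (only happens for finitely many n, irrelevant for the limit)
ratio : ℕ → ℕ → ℚ
ratio p n with denom p n
... | zero = 0ℚ
... | suc d = (+ numer p n) /ℚ suc d

ConvergesTo : (ℕ → ℚ) → ℚ → Set
ConvergesTo f l = ∀ (ε : ℚ) → Positive ε → ∃ λ N → ∀ n → n ≥ N → ∣ f n - l ∣ < ε

{-# OPTIONS --safe #-}
module Submission where

-- Write q = p − 1 and r_t = ⌊n/(2p^t)⌉.  Rounding gives |2 p^t r_t − n| ≤ p^t, so for a fixed
-- cut-off T the doubled partial sum 2(r_1 + ⋯ + r_T) lies within T of n(1 − p^−T)/q, while
-- 2^t r_t ≤ n bounds the tail r_{T+1} + ⋯ by n/2^T.  The denominator ⌊(n−1)/q⌋ is within 1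
-- of n/q, so with T = 4bq every error is a small multiple of denominator/b, and
-- |numerator/denominator − 1/2| < 1/b as soon as the denominator exceeds b(T + 2).

open import Defs
open import Data.Nat.Primality using (Prime; ¬prime[0]; ¬prime[1])

open import Data.Empty using (⊥-elim)
open import Data.Nat as ℕ
  using (ℕ; zero; suc; NonZero; _+_; _*_; _∸_; _^_; _≤_; _<_; _≥_; z≤n; s≤s; ∣_-_∣)
open import Data.Nat.Properties as ℕ using ()
open import Data.Nat.DivMod as ℕ using (_/_; _%_)
open import Data.Nat.Coprimality using (Coprime)
open import Data.Nat.Tactic.RingSolver using (solve-∀)
open import Data.Integer as ℤ using (+_; -[1+_]; _⊖_)
import Data.Integer.Properties as ℤ
import Data.Integer.DivMod as ℤ
import Data.Integer.Tactic.RingSolver as ℤ-Ring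
open import Data.Rational as ℚ using (mkℚ; floor; ½; toℚᵘ)
import Data.Rational.Properties as ℚ
open import Data.Rational.Unnormalised as ℚᵘ using (mkℚᵘ; *≡*; *<*)
import Data.Rational.Unnormalised.Properties as ℚᵘ
open import Data.Product using (_,_)
open import Data.Sum using (inj₁; inj₂)
open import Relation.Binary.PropositionalEquality

m<m/n*n+n : ∀ m n .{{_ : NonZero n}} → m < m / n * n + n
m<m/n*n+n m n = begin-strict
  m                  ≡⟨ ℕ.m≡m%n+[m/n]*n m n ⟩
  m % n + m / n * n  <⟨ ℕ.+-monoˡ-< (m / n * n) (ℕ.m%n<n m n) ⟩
  n + m / n * n      ≡⟨ ℕ.+-comm n _ ⟩
  m / n * n + n      ∎
  where open ℕ.≤-Reasoning

*-cross⇒/≡ : ∀ m n o p .{{_ : NonZero o}} .{{_ : NonZero p}} →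
             m * p ≡ n * o → m / o ≡ n / p
*-cross⇒/≡ m n o@(suc _) p@(suc _) eq = begin
  m / o            ≡⟨ ℕ.m*n/o*n≡m/o m p o ⟨
  m * p / (o * p)  ≡⟨ ℕ./-congˡ eq ⟩
  n * o / (o * p)  ≡⟨ ℕ./-congʳ {m = n * o} (ℕ.*-comm o p) ⟩
  n * o / (p * o)  ≡⟨ ℕ.m*n/o*n≡m/o n o p ⟩
  n / p            ∎
  where open ≡-Reasoning

n<2^n : ∀ n → n < 2 ^ n
n<2^n zero = s≤s z≤n
n<2^n (suc n) = ℕ.+-mono-≤-< (ℕ.m^n>0 2 n) (subst (n <_) (sym (ℕ.+-identityʳ (2 ^ n))) (n<2^n n))

2*m*r≤n+m⇒m*r≤n : ∀ m r n → 2 * m * r ≤ n + m → m * r ≤ n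
2*m*r≤n+m⇒m*r≤n m zero n _ = subst (_≤ n) (sym (ℕ.*-zeroʳ m)) z≤n
2*m*r≤n+m⇒m*r≤n m r@(suc _) n 2mr≤n+m = ℕ.+-cancelʳ-≤ m _ _ (begin
  m * r + m      ≤⟨ ℕ.+-monoʳ-≤ (m * r) (ℕ.m≤m*n m r) ⟩
  m * r + m * r  ≡⟨ double m r ⟩
  2 * m * r      ≤⟨ 2mr≤n+m ⟩
  n + m          ∎)
  where
  open ℕ.≤-Reasoning
  double : ∀ m r → m * r + m * r ≡ 2 * m * r
  double = solve-∀

∣m⊖n∣≡∣m-n∣ : ∀ m n → ℤ.∣ m ⊖ n ∣ ≡ ∣ m - n ∣
∣m⊖n∣≡∣m-n∣ m n with ℕ.≤-total m n
... | inj₁ m≤n = trans (ℤ.∣⊖∣-≤ m≤n) (sym (ℕ.m≤n⇒∣m-n∣≡n∸m m≤n))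
... | inj₂ n≤m = trans (cong ℤ.∣_∣ (ℤ.⊖-≥ n≤m)) (sym (ℕ.m≤n⇒∣n-m∣≡n∸m n≤m))

∣m-n∣<o : ∀ {m n o} → m < n + o → n < m + o → ∣ m - n ∣ < o
∣m-n∣<o {m} {n} {o} m<n+o n<m+o with ℕ.≤-total m n
... | inj₁ m≤n = subst₂ _<_ (sym (ℕ.m≤n⇒∣m-n∣≡n∸m m≤n)) (ℕ.m+n∸m≡n m o) (ℕ.∸-monoˡ-< n<m+o m≤n)
... | inj₂ n≤m = subst₂ _<_ (sym (ℕ.m≤n⇒∣n-m∣≡n∸m n≤m)) (ℕ.m+n∸m≡n n o) (ℕ.∸-monoˡ-< m<n+o n≤m)

floor-≃ : ∀ x A B → toℚᵘ x ℚᵘ.≃ mkℚᵘ (+ A) B → floor x ≡ + (A / suc B)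
floor-≃ (mkℚ (+ a) d _) A B (*≡* eq) = trans (ℤ.div-pos-is-/ℕ (+ a) (suc d))
  (cong +_ (*-cross⇒/≡ a A (suc d) (suc B)
    (ℤ.+-injective (trans (ℤ.pos-* a (suc B)) (trans eq (sym (ℤ.pos-* A (suc d))))))))
floor-≃ (mkℚ -[1+ a ] d _) A B (*≡* eq) with trans eq (sym (ℤ.pos-* A (suc d)))
... | ()

toℚᵘ-/ : ∀ i d → toℚᵘ (i ℚ./ suc d) ℚᵘ.≃ mkℚᵘ i d
toℚᵘ-/ i d = ℚ.toℚᵘ-fromℚᵘ (mkℚᵘ i d)

-- In ℚᵘ the difference N/D − 1/2 is (2N − D)/(2D) on the nose, with no gcd normalisation.
∣/-½∣< : ∀ N d a′ b′ .{c : Coprime (suc a′) (suc b′)} → suc b′ * ∣ N * 2 - suc d ∣ < 2 * suc d →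
         ℚ.∣ + N ℚ./ suc d ℚ.- ½ ∣ ℚ.< mkℚ (+ suc a′) b′ c
∣/-½∣< N d a′ b′ close = ℚ.toℚᵘ-cancel-< (ℚᵘ.<-respˡ-≃ (ℚᵘ.≃-sym toℚᵘ-∣x-½∣) (*<* cross))
  where
  x = + N ℚ./ suc d
  D = suc d
  toℚᵘ-∣x-½∣ : toℚᵘ ℚ.∣ x ℚ.- ½ ∣ ℚᵘ.≃ ℚᵘ.∣ mkℚᵘ (+ N) d ℚᵘ.- ℚᵘ.½ ∣
  toℚᵘ-∣x-½∣ = begin
    toℚᵘ ℚ.∣ x ℚ.- ½ ∣                  ≈⟨ ℚ.toℚᵘ-homo-∣-∣ (x ℚ.- ½) ⟩
    ℚᵘ.∣ toℚᵘ (x ℚ.- ½) ∣               ≈⟨ ℚᵘ.∣-∣-cong (ℚ.toℚᵘ-homo-+ x (ℚ.- ½)) ⟩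
    ℚᵘ.∣ toℚᵘ x ℚᵘ.- ℚᵘ.½ ∣             ≈⟨ ℚᵘ.∣-∣-cong (ℚᵘ.+-congˡ (ℚᵘ.- ℚᵘ.½) (toℚᵘ-/ (+ N) d)) ⟩
    ℚᵘ.∣ mkℚᵘ (+ N) d ℚᵘ.- ℚᵘ.½ ∣       ∎
    where open ℚᵘ.≃-Reasoning
  numerator : + N ℤ.* + 2 ℤ.+ ℤ.- + 1 ℤ.* + D ≡ N * 2 ⊖ D
  numerator = trans (cong₂ ℤ._+_ (sym (ℤ.pos-* N 2)) (ℤ.-1*i≡-i (+ D))) (ℤ.m-n≡m⊖n (N * 2) D)
  cross-ℕ : ∣ N * 2 - D ∣ * suc b′ < suc a′ * (D * 2)
  cross-ℕ = begin-strict
    ∣ N * 2 - D ∣ * suc b′  ≡⟨ ℕ.*-comm _ (suc b′) ⟩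
    suc b′ * ∣ N * 2 - D ∣  <⟨ close ⟩
    2 * D                   ≡⟨ ℕ.*-comm 2 D ⟩
    D * 2                   ≤⟨ ℕ.m≤n*m (D * 2) (suc a′) ⟩
    suc a′ * (D * 2)        ∎
    where open ℕ.≤-Reasoning
  cross : + ℤ.∣ + N ℤ.* + 2 ℤ.+ ℤ.- + 1 ℤ.* + D ∣ ℤ.* + suc b′ ℤ.< + suc a′ ℤ.* + (D * 2)
  cross rewrite numerator | ∣m⊖n∣≡∣m-n∣ (N * 2) D =
    subst₂ ℤ._<_ (ℤ.pos-* ∣ N * 2 - D ∣ (suc b′)) (ℤ.pos-* (suc a′) (D * 2)) (ℤ.+<+ cross-ℕ)

roundNN-floor : ∀ x k → floor (x ℚ.+ ½) ≡ + k → roundNN x ≡ k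
roundNN-floor x k eq with floor (x ℚ.+ ½)
roundNN-floor x k refl | .(+ k) = refl

mkℚᵘ-+-½ : ∀ n m → mkℚᵘ (+ n) (ℕ.pred (2 * suc m)) ℚᵘ.+ ℚᵘ.½ ℚᵘ.≃ mkℚᵘ (+ (n + suc m)) (ℕ.pred (2 * suc m))
mkℚᵘ-+-½ n m = *≡* (identity (+ n) (+ suc m))
  where
  identity : ∀ N M → (N ℤ.* + 2 ℤ.+ + 1 ℤ.* (+ 2 ℤ.* M)) ℤ.* (+ 2 ℤ.* M) ≡ (N ℤ.+ M) ℤ.* ((+ 2 ℤ.* M) ℤ.* + 2)
  identity = ℤ-Ring.solve-∀

roundNN-half : ∀ n m .{{_ : NonZero m}} .{{_ : NonZero (2 * m)}} →
               roundNN (+ n ℚ./ (2 * m)) ≡ (n + m) / (2 * m)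
roundNN-half n m@(suc m′) = roundNN-floor x ((n + m) / (2 * m)) (floor-≃ (x ℚ.+ ½) (n + m) _ x+½≃)
  where
  x = + n ℚ./ (2 * m)
  open ℚᵘ.≃-Reasoning
  x+½≃ : toℚᵘ (x ℚ.+ ½) ℚᵘ.≃ mkℚᵘ (+ (n + m)) (ℕ.pred (2 * m))
  x+½≃ = begin
    toℚᵘ (x ℚ.+ ½)                          ≈⟨ ℚ.toℚᵘ-homo-+ x ½ ⟩
    toℚᵘ x ℚᵘ.+ ℚᵘ.½                        ≈⟨ ℚᵘ.+-congˡ ℚᵘ.½ (toℚᵘ-/ (+ n) _) ⟩
    mkℚᵘ (+ n) (ℕ.pred (2 * m)) ℚᵘ.+ ℚᵘ.½   ≈⟨ mkℚᵘ-+-½ n m′ ⟩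
    mkℚᵘ (+ (n + m)) (ℕ.pred (2 * m))       ∎

module _ (q n t : ℕ) where
  private
    instance
      p^t≢0 : NonZero (suc q ^ t)
      p^t≢0 = ℕ.m^n≢0 (suc q) t
      2p^t≢0 : NonZero (2 * suc q ^ t)
      2p^t≢0 = ℕ.m*n≢0 2 (suc q ^ t)
    P = suc q ^ t
    r = term (suc q) n t
    r≡ : r ≡ (n + P) / (2 * P)
    r≡ = roundNN-half n P

  term-upper : 2 * suc q ^ t * term (suc q) n t ≤ n + suc q ^ t
  term-upper = begin
    2 * P * r                    ≡⟨ ℕ.*-comm (2 * P) r ⟩
    r * (2 * P)                  ≡⟨ cong (_* (2 * P)) r≡ ⟩
    (n + P) / (2 * P) * (2 * P)  ≤⟨ ℕ.m/n*n≤m (n + P) (2 * P) ⟩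
    n + P                        ∎
    where open ℕ.≤-Reasoning

  term-lower : n ≤ 2 * suc q ^ t * term (suc q) n t + suc q ^ t
  term-lower = ℕ.<⇒≤ (ℕ.+-cancelʳ-< P n (2 * P * r + P) (begin-strict
    n + P                                <⟨ m<m/n*n+n (n + P) (2 * P) ⟩
    (n + P) / (2 * P) * (2 * P) + 2 * P  ≡⟨ cong (λ x → x * (2 * P) + 2 * P) r≡ ⟨
    r * (2 * P) + 2 * P                  ≡⟨ regroup r P ⟩
    2 * P * r + P + P                    ∎))
    where
    open ℕ.≤-Reasoning
    regroup : ∀ r P → r * (2 * P) + 2 * P ≡ 2 * P * r + P + P
    regroup = solve-∀

term-tail : ∀ k n t → 2 ^ t * term (suc (suc k)) n t ≤ n
term-tail k n t = ℕ.≤-trans (ℕ.*-monoˡ-≤ (term (suc (suc k)) n t) (ℕ.^-monoˡ-≤ t (s≤s (s≤s z≤n))))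
                            (2*m*r≤n+m⇒m*r≤n _ _ n (term-upper (suc k) n t))

sumFrom1-+ : ∀ T m f → sumFrom1 (m + T) f ≡ sumFrom1 T f + sumFrom1 m (λ s → f (s + T))
sumFrom1-+ T zero f = sym (ℕ.+-identityʳ _)
sumFrom1-+ T (suc m) f = trans (cong (_+ f (suc (m + T))) (sumFrom1-+ T m f)) (ℕ.+-assoc (sumFrom1 T f) _ _)

module _ {c x : ℕ} {f : ℕ → ℕ} (bounded : ∀ s → c * 2 ^ s * f s ≤ x) where
  private
    invariant : ∀ m → 2 ^ m * (c * sumFrom1 m f) + x ≤ x * 2 ^ m
    invariant zero = ℕ.≤-reflexive (base c x)
      where
      base : ∀ c x → 1 * (c * 0) + x ≡ x * 1
      base = solve-∀
    invariant (suc m) = begin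
      2 * 2 ^ m * (c * (S + f (suc m))) + x   ≡⟨ expand (2 ^ m) c S (f (suc m)) x ⟩
      2 * (2 ^ m * (c * S)) + c * (2 * 2 ^ m) * f (suc m) + x ≤⟨ ℕ.+-monoˡ-≤ x (ℕ.+-monoʳ-≤ (2 * (2 ^ m * (c * S))) (bounded (suc m))) ⟩
      2 * (2 ^ m * (c * S)) + x + x            ≡⟨ double (2 ^ m * (c * S)) x ⟩
      2 * (2 ^ m * (c * S) + x)                ≤⟨ ℕ.*-monoʳ-≤ 2 (invariant m) ⟩
      2 * (x * 2 ^ m)                          ≡⟨ shift x (2 ^ m) ⟩
      x * (2 * 2 ^ m)                          ∎
      where
      open ℕ.≤-Reasoning
      S = sumFrom1 m f
      expand : ∀ y c S z x → 2 * y * (c * (S + z)) + x ≡ 2 * (y * (c * S)) + c * (2 * y) * z + x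
      expand = solve-∀
      double : ∀ y x → 2 * y + x + x ≡ 2 * (y + x)
      double = solve-∀
      shift : ∀ x y → 2 * (x * y) ≡ x * (2 * y)
      shift = solve-∀

  sumFrom1-dyadic : ∀ m → c * sumFrom1 m f ≤ x
  sumFrom1-dyadic m = ℕ.*-cancelˡ-≤ (2 ^ m) {{ℕ.m^n≢0 2 m}}
    (ℕ.≤-trans (ℕ.m+n≤o⇒m≤o _ (invariant m)) (ℕ.≤-reflexive (ℕ.*-comm x (2 ^ m))))

module _ {q n : ℕ} {r : ℕ → ℕ} where
  private
    p = suc q
    S = λ T → sumFrom1 T r

  -- n(1 − p^−T)/q − T ≤ 2 (r 1 + ⋯ + r T) ≤ n(1 − p^−T)/q + T, with the denominators cleared.
  sumFrom1-upper : (∀ t → 2 * suc q ^ t * r t ≤ n + suc q ^ t) →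
                   ∀ T → 2 * q * suc q ^ T * sumFrom1 T r + n ≤ (n + q * T) * suc q ^ T
  sumFrom1-upper _ zero = ℕ.≤-reflexive (base q n)
    where
    base : ∀ q n → 2 * q * 1 * 0 + n ≡ (n + q * 0) * 1
    base = solve-∀
  sumFrom1-upper upper (suc T) = ℕ.+-cancelʳ-≤ (q * n) _ _ (begin
    2 * q * (p * P) * (S T + r′) + n + q * n          ≡⟨ lhs q P (S T) r′ n ⟩
    p * (2 * q * P * S T + n) + q * (2 * (p * P) * r′) ≤⟨ ℕ.+-mono-≤ (ℕ.*-monoʳ-≤ p (sumFrom1-upper upper T))
                                                                      (ℕ.*-monoʳ-≤ q (upper (suc T))) ⟩
    p * ((n + q * T) * P) + q * (n + p * P)           ≡⟨ rhs q P n T ⟩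
    (n + q * suc T) * (p * P) + q * n                 ∎)
    where
    open ℕ.≤-Reasoning
    P = p ^ T
    r′ = r (suc T)
    lhs : ∀ q P S r n → 2 * q * (suc q * P) * (S + r) + n + q * n
                      ≡ suc q * (2 * q * P * S + n) + q * (2 * (suc q * P) * r)
    lhs = solve-∀
    rhs : ∀ q P n T → suc q * ((n + q * T) * P) + q * (n + suc q * P)
                    ≡ (n + q * suc T) * (suc q * P) + q * n
    rhs = solve-∀

  sumFrom1-lower : (∀ t → n ≤ 2 * suc q ^ t * r t + suc q ^ t) →
                   ∀ T → n * suc q ^ T ≤ (2 * q * sumFrom1 T r + q * T) * suc q ^ T + n
  sumFrom1-lower _ zero = ℕ.≤-reflexive (base q n)
    where
    base : ∀ q n → n * 1 ≡ (2 * q * 0 + q * 0) * 1 + n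
    base = solve-∀
  sumFrom1-lower lower (suc T) = ℕ.+-cancelʳ-≤ (q * n) _ _ (begin
    n * (p * P) + q * n                                         ≡⟨ lhs q P n ⟩
    p * (n * P) + q * n                                         ≤⟨ ℕ.+-mono-≤ (ℕ.*-monoʳ-≤ p (sumFrom1-lower lower T))
                                                                                (ℕ.*-monoʳ-≤ q (lower (suc T))) ⟩
    p * ((2 * q * S T + q * T) * P + n) + q * (2 * (p * P) * r′ + p * P) ≡⟨ rhs q P (S T) r′ n T ⟩
    (2 * q * (S T + r′) + q * suc T) * (p * P) + n + q * n     ∎)
    where
    open ℕ.≤-Reasoning
    P = p ^ T
    r′ = r (suc T)
    lhs : ∀ q P n → n * (suc q * P) + q * n ≡ suc q * (n * P) + q * n
    lhs = solve-∀
    rhs : ∀ q P S r n T → suc q * ((2 * q * S + q * T) * P + n) + q * (2 * (suc q * P) * r + suc q * P)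
                        ≡ (2 * q * (S + r) + q * suc T) * (suc q * P) + n + q * n
    rhs = solve-∀

module _ (k n′ : ℕ) where
  private
    q = suc k
    D = denom (suc q) (suc n′)

  q*denom<n : q * D < suc n′
  q*denom<n = s≤s (subst (_≤ n′) (ℕ.*-comm D q) (ℕ.m/n*n≤m n′ q))

  n≤q*denom+q : suc n′ ≤ q * D + q
  n≤q*denom+q = subst (suc n′ ≤_) (cong (_+ q) (ℕ.*-comm D q)) (m<m/n*n+n n′ q)

module _ (k b n D : ℕ) .{{_ : NonZero b}}
         (qD<n : suc k * D < n) (n≤qD+q : n ≤ suc k * D + suc k)
         (D-large : b * (4 * b * suc k + 2) < D) where
  private
    q = suc k
    p = suc q
    T = 4 * b * q
    P = p ^ T
    r = term p n
    S = sumFrom1 T r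
    R = sumFrom1 (n ∸ T) (λ s → r (s + T))
    N = numer p n

    instance
      P≢0 : NonZero P
      P≢0 = ℕ.m^n≢0 p T
      D≢0 : NonZero D
      D≢0 = ℕ.>-nonZero (ℕ.≤-trans (s≤s z≤n) D-large)

    bT<D : b * suc T < D
    bT<D = ℕ.<-≤-trans (ℕ.*-monoʳ-< b (ℕ.n<1+n (suc T))) (ℕ.<⇒≤ (subst (λ x → b * x < D) (ℕ.+-comm T 2) D-large))

    T≤n : T ≤ n
    T≤n = ℕ.<⇒≤ (begin-strict
      T          ≤⟨ ℕ.m≤n*m T b ⟩
      b * T      ≤⟨ ℕ.*-monoʳ-≤ b (ℕ.n≤1+n T) ⟩
      b * suc T  <⟨ bT<D ⟩
      D          ≤⟨ ℕ.m≤n*m D q ⟩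
      q * D      <⟨ qD<n ⟩
      n          ∎)
      where open ℕ.≤-Reasoning

    T≤P : T ≤ P
    T≤P = ℕ.≤-trans (ℕ.<⇒≤ (n<2^n T)) (ℕ.^-monoˡ-≤ T (s≤s (s≤s z≤n)))

    N≡S+R : N ≡ S + R
    N≡S+R = trans (cong (λ x → sumFrom1 x r) (sym (ℕ.m∸n+n≡m T≤n))) (sumFrom1-+ T (n ∸ T) r)

    S≤N : S ≤ N
    S≤N = subst (S ≤_) (sym N≡S+R) (ℕ.m≤m+n S R)

    2qS≤n+qT : 2 * q * S ≤ n + q * T
    2qS≤n+qT = ℕ.*-cancelʳ-≤ _ _ P (begin
      2 * q * S * P          ≡⟨ swap (2 * q) S P ⟩
      2 * q * P * S          ≤⟨ ℕ.m+n≤o⇒m≤o _ (sumFrom1-upper (term-upper q n) T) ⟩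
      (n + q * T) * P        ∎)
      where
      open ℕ.≤-Reasoning
      swap : ∀ x y z → x * y * z ≡ x * z * y
      swap = solve-∀

    2^T*R≤n : 2 ^ T * R ≤ n
    2^T*R≤n = sumFrom1-dyadic {c = 2 ^ T} {f = λ s → r (s + T)} bounded (n ∸ T)
      where
      bounded : ∀ s → 2 ^ T * 2 ^ s * r (s + T) ≤ n
      bounded s = subst (λ x → x * r (s + T) ≤ n)
                        (trans (ℕ.^-distribˡ-+-* 2 s T) (ℕ.*-comm (2 ^ s) (2 ^ T)))
                        (term-tail k n (s + T))

    2bR≤D : 2 * b * R ≤ D
    2bR≤D = ℕ.*-cancelˡ-≤ (2 ^ T) {{ℕ.m^n≢0 2 T}} (begin
      2 ^ T * (2 * b * R)      ≡⟨ swap (2 ^ T) (2 * b) R ⟩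
      2 * b * (2 ^ T * R)      ≤⟨ ℕ.*-monoʳ-≤ (2 * b) 2^T*R≤n ⟩
      2 * b * n                ≤⟨ ℕ.*-monoʳ-≤ (2 * b) n≤qD+q ⟩
      2 * b * (q * D + q)      ≤⟨ ℕ.*-monoʳ-≤ (2 * b) (ℕ.+-monoʳ-≤ (q * D) (ℕ.m≤m*n q D)) ⟩
      2 * b * (q * D + q * D)  ≡⟨ collect b q D ⟩
      T * D                    ≤⟨ ℕ.*-monoˡ-≤ D (ℕ.<⇒≤ (n<2^n T)) ⟩
      2 ^ T * D                ∎)
      where
      open ℕ.≤-Reasoning
      swap : ∀ x y z → x * (y * z) ≡ y * (x * z)
      swap = solve-∀
      collect : ∀ b q D → 2 * b * (q * D + q * D) ≡ 4 * b * q * D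
      collect = solve-∀

  numer-upper : b * (numer (suc (suc k)) n * 2) < b * D + 2 * D
  numer-upper = ℕ.*-cancelˡ-< q _ _ (begin-strict
    q * (b * (N * 2))                    ≡⟨ cong (λ x → q * (b * (x * 2))) N≡S+R ⟩
    q * (b * ((S + R) * 2))              ≡⟨ split q b S R ⟩
    b * (2 * q * S) + q * (2 * b * R)    ≤⟨ ℕ.+-mono-≤ (ℕ.*-monoʳ-≤ b 2qS≤n+qT) (ℕ.*-monoʳ-≤ q 2bR≤D) ⟩
    b * (n + q * T) + q * D              ≤⟨ ℕ.+-monoˡ-≤ (q * D) (ℕ.*-monoʳ-≤ b (ℕ.+-monoˡ-≤ (q * T) n≤qD+q)) ⟩
    b * (q * D + q + q * T) + q * D      ≡⟨ collect q b D T ⟩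
    q * (b * D + (b * suc T + D))        <⟨ ℕ.*-monoʳ-< q (ℕ.+-monoʳ-< (b * D) (ℕ.+-monoˡ-< D bT<D)) ⟩
    q * (b * D + (D + D))                ≡⟨ cong (λ x → q * (b * D + x)) (double D) ⟩
    q * (b * D + 2 * D)                  ∎)
    where
    open ℕ.≤-Reasoning
    split : ∀ q b S R → q * (b * ((S + R) * 2)) ≡ b * (2 * q * S) + q * (2 * b * R)
    split = solve-∀
    collect : ∀ q b D T → b * (q * D + q + q * T) + q * D ≡ q * (b * D + (b * suc T + D))
    collect = solve-∀
    double : ∀ D → D + D ≡ 2 * D
    double = solve-∀

  numer-lower : b * D < b * (numer (suc (suc k)) n * 2) + 2 * D
  numer-lower = ℕ.*-cancelˡ-< (q * P) _ _ (begin-strict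
    q * P * (b * D)                                   ≡⟨ regroup q P b D ⟩
    b * (P * (q * D))                                 <⟨ ℕ.*-monoʳ-< b (ℕ.*-monoʳ-< P qD<n) ⟩
    b * (P * n)                                       ≡⟨ cong (b *_) (ℕ.*-comm P n) ⟩
    b * (n * P)                                       ≤⟨ ℕ.*-monoʳ-≤ b (sumFrom1-lower (term-lower q n) T) ⟩
    b * ((2 * q * S + q * T) * P + n)                 ≤⟨ ℕ.*-monoʳ-≤ b (ℕ.+-monoʳ-≤ ((2 * q * S + q * T) * P) n≤qD+q) ⟩
    b * ((2 * q * S + q * T) * P + (q * D + q))       ≡⟨ expand q P b S T D ⟩
    q * (P * (b * (S * 2)) + (b * T * P + b * suc D)) ≤⟨ ℕ.*-monoʳ-≤ q (ℕ.+-monoʳ-≤ (P * (b * (S * 2))) (ℕ.+-mono-≤ bTP≤DP bD≤PD)) ⟩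
    q * (P * (b * (S * 2)) + (D * P + P * D))         ≡⟨ collect q P b S D ⟩
    q * P * (b * (S * 2) + 2 * D)                     ≤⟨ ℕ.*-monoʳ-≤ (q * P) (ℕ.+-monoˡ-≤ (2 * D) (ℕ.*-monoʳ-≤ b (ℕ.*-monoˡ-≤ 2 S≤N))) ⟩
    q * P * (b * (N * 2) + 2 * D)                     ∎)
    where
    open ℕ.≤-Reasoning
    bTP≤DP : b * T * P ≤ D * P
    bTP≤DP = ℕ.*-monoˡ-≤ P (ℕ.≤-trans (ℕ.*-monoʳ-≤ b (ℕ.n≤1+n T)) (ℕ.<⇒≤ bT<D))
    double : ∀ D → D + D ≡ D * 2
    double = solve-∀
    scale : ∀ b D q → b * (D * (4 * q)) ≡ 4 * b * q * D
    scale = solve-∀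
    bD≤PD : b * suc D ≤ P * D
    bD≤PD = begin
      b * suc D          ≤⟨ ℕ.*-monoʳ-≤ b (ℕ.+-monoˡ-≤ D (ℕ.>-nonZero⁻¹ D)) ⟩
      b * (D + D)        ≡⟨ cong (b *_) (double D) ⟩
      b * (D * 2)        ≤⟨ ℕ.*-monoʳ-≤ b (ℕ.*-monoʳ-≤ D (ℕ.≤-trans (s≤s (s≤s z≤n)) (ℕ.m≤m*n 4 q))) ⟩
      b * (D * (4 * q))  ≡⟨ scale b D q ⟩
      T * D              ≤⟨ ℕ.*-monoˡ-≤ D T≤P ⟩
      P * D              ∎
    regroup : ∀ q P b D → q * P * (b * D) ≡ b * (P * (q * D))
    regroup = solve-∀
    expand : ∀ q P b S T D → b * ((2 * q * S + q * T) * P + (q * D + q))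
                           ≡ q * (P * (b * (S * 2)) + (b * T * P + b * suc D))
    expand = solve-∀
    collect : ∀ q P b S D → q * (P * (b * (S * 2)) + (D * P + P * D)) ≡ q * P * (b * (S * 2) + 2 * D)
    collect = solve-∀

  numer-close : b * ∣ numer (suc (suc k)) n * 2 - D ∣ < 2 * D
  numer-close = subst (_< 2 * D) (sym (ℕ.*-distribˡ-∣-∣ b (N * 2) D)) (∣m-n∣<o numer-upper numer-lower)

∣ratio-½∣< : ∀ p n a′ b′ .{c : Coprime (suc a′) (suc b′)} → 0 < denom p n →
             suc b′ * ∣ numer p n * 2 - denom p n ∣ < 2 * denom p n →
             ℚ.∣ ratio p n ℚ.- ½ ∣ ℚ.< mkℚ (+ suc a′) b′ c
∣ratio-½∣< p n a′ b′ denom>0 close with denom p n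
... | suc d = ∣/-½∣< (numer p n) d a′ b′ close

proposition5p3 : ∀ (p : ℕ) → Prime p → ConvergesTo (ratio p) ½
proposition5p3 0 p-prime = ⊥-elim (¬prime[0] p-prime)
proposition5p3 1 p-prime = ⊥-elim (¬prime[1] p-prime)
proposition5p3 (suc (suc k)) _ (mkℚ (+ suc a′) b′ _) _ = suc (M * q) , close
  where
  q = suc k
  b = suc b′
  M = suc (b * (4 * b * q + 2))
  close : ∀ n → n ≥ suc (M * q) → ℚ.∣ ratio (suc q) n ℚ.- ½ ∣ ℚ.< mkℚ (+ suc a′) b′ _
  close (suc n′) (s≤s Mq≤n′) = ∣ratio-½∣< (suc q) (suc n′) a′ b′ (ℕ.≤-trans (s≤s z≤n) M≤D)
    (numer-close k b (suc n′) D (q*denom<n k n′) (n≤q*denom+q k n′) M≤D)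
    where
    D = denom (suc q) (suc n′)
    M≤D : M ≤ D
    M≤D = subst (_≤ D) (ℕ.m*n/n≡m M q) (ℕ./-monoˡ-≤ q Mq≤n′)
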